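{- For every $\varepsilon>0$ and $n\in\mathbb{N}$ there exist $N\in\mathbb{N}$ and an integer $m\le 2/\varepsilon$ such that the following holds for every $N$-partitioned hypergraph $H$ and every choice of vertices $\gamma_{ik}\in V_{ik}$, $1\le i<k\le N$. There exist an $n$-partitioned subhypergraph $H_0$ of $H$ with index set $I\subseteq[N]$ and (not necessarily distinct) vertices $\alpha^1_{ij},\ldots,\alpha^m_{ij}\in V_{ij}$, $i<j$, $i,j\in I$, such that in every $(i,j,k)$-triad with $i<j<k$, $i,j,k\in I$: (a) the degree of $\gamma_{ik}$ in $H_0$ is smaller by at most $\varepsilon$ than its degree in $H$; (b) the degree of every vertex of $V_{ik}$ other than $\gamma_{ik}$ is the same in $H_0$ as in $H$; (c) for every right neighbor $\beta$ of $\gamma_{ik}$ (in this triad of $H_0$) there exists $\ell\in[m]$ such that $\{\alpha^\ell_{ij},\beta,\gamma_{ik}\}$ is an edge (of $H_0$).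
   Context: An $N$-partitioned hypergraph $H$ is a $3$-uniform hypergraph whose vertex set is partitioned into nonempty finite sets $V_{ij}$, $1\le i<j\le N$, such that every edge has one vertex in each of $V_{ij},V_{ik},V_{jk}$ for some $1\le i<j<k\le N$. For $i<j<k$, the $(i,j,k)$-triad is the set of edges with one vertex in each of $V_{ij},V_{ik},V_{jk}$; vertices of $V_{ik}$ are its top vertices. The degree of a top vertex $v\in V_{ik}$ in the $(i,j,k)$-triad is the number of edges of the triad containing $v$ divided by $|V_{ij}||V_{jk}|$. A vertex $w\in V_{jk}$ is a right neighbor of the top vertex $v\in V_{ik}$ (in the $(i,j,k)$-triad) if some edge of the triad contains both $v$ and $w$. For $I\subseteq[N]$, the subhypergraph induced by $I$ has parts $V_{ij}$, $i<j$, $i,j\in I$ (original indices) and all edges of $H$ in the union of these parts; $I$ is its index set. A subhypergraph of $H$ is obtained from an induced subhypergraph by deleting some edges. -}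

module Defs where

open import Data.Nat using (ℕ; zero; suc; _+_; _*_)
open import Data.Fin using (Fin; zero; suc)
open import Data.Bool using (Bool; true; false)
open import Data.Integer using (+_)
open import Data.Rational using (ℚ; _/_; _÷_; Positive)
open import Data.Rational.Properties using (pos⇒nonZero)

sumFin : (n : ℕ) → (Fin n → ℕ) → ℕ
sumFin zero    f = 0
sumFin (suc n) f = f zero + sumFin n (λ i → f (suc i))

indicator : Bool → ℕ
indicator true  = 1
indicator false = 0

-- The part V_ij (i < j) is Fin (suc (sz i j)), hence nonempty.
-- Values of sz i j for i ≥ j are irrelevant junk (never used by the statement).
-- An edge of the (i,j,k)-triad (i < j < k) with vertices a ∈ V_ij, b ∈ V_ik,
-- c ∈ V_jk is recorded by  edge i j k a b c ≡ true ; values for non-increasing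
-- triples (i,j,k) are irrelevant junk.
record PHyp (N : ℕ) : Set where
  field
    sz   : Fin N → Fin N → ℕ
    edge : (i j k : Fin N) →
           Fin (suc (sz i j)) → Fin (suc (sz i k)) → Fin (suc (sz j k)) → Bool

open PHyp public

part : ∀ {N} → PHyp N → Fin N → Fin N → ℕ
part H i j = suc (sz H i j)

triadDegree : (a b c : ℕ) →
              (Fin (suc a) → Fin (suc b) → Fin (suc c) → Bool) →
              Fin (suc b) → ℚ
triadDegree a b c T v =
  (+ sumFin (suc a) (λ x → sumFin (suc c) (λ z → indicator (T x v z))))
    / (suc a * suc c)

twoOver : (ε : ℚ) → .{{Positive ε}} → ℚ
twoOver ε = ((+ 2) / 1) ÷ ε
  where instance _ = pos⇒nonZero ε

{-# OPTIONS --safe #-}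
-- Write ε = (1+p)/(1+q) and m = ⌊2/ε⌋, so that (1+m)ε > 2.  In a triad (i,j,k), call an
-- m-tuple t of vertices of V_ij covering if at most 2|V_ij||V_jk|/(1+m) of the edges at γ_ik
-- have their V_jk-vertex joined to γ_ik by no entry of t.  Deleting exactly those edges costs
-- γ_ik less than ε of degree, touches no other top vertex, and leaves every right neighbour of
-- γ_ik joined to it through some entry of t.  Summed over all tuples, the number of such edges
-- is Σ_z d_z (|V_ij| − d_z)^m ≤ |V_jk| |V_ij|^(m+1)/(1+m) by Bernoulli's inequality, so by
-- Markov at least half of the tuples are covering for each k, and for any list of candidate
-- indices k some tuple covers at least half of them.  Indices are then picked greedily: each
-- new index halves the remaining candidates once for every earlier index, so N = 2^(n(n+1)/2)
-- indices leave room for n of them, every pair of which carries a tuple covering all later triads.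
module Submission where

open import Defs
open import Data.Nat as ℕ using (ℕ; suc)
open import Data.Fin using (Fin)
open import Data.Bool using (Bool)
open import Data.Vec.Functional using (Vector)
open import Data.Nat.Coprimality using (Coprime)
open import Data.List using (List; length; filter)
open import Relation.Nullary using (Dec)
open import Relation.Binary.PropositionalEquality using (_≡_)
open import Data.Product using (∃)

module Sums where

  open import Data.Nat using (zero; _+_; _*_; _^_; _≤_; z≤n)
  open import Data.Nat.Properties
  open import Algebra.Properties.CommutativeSemigroup +-commutativeSemigroup using (interchange)
  open import Data.Fin using (zero; suc)
  open import Data.Vec.Functional using ([]; _∷_)
  open import Data.Product using (_,_)
  open import Relation.Nullary using (yes; no)
  open import Relation.Binary.PropositionalEquality using (refl; sym; trans; cong; cong₂; subst; subst₂)

  sumFin-cong : ∀ n {f g : Fin n → ℕ} → (∀ i → f i ≡ g i) → sumFin n f ≡ sumFin n g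
  sumFin-cong zero    f≗g = refl
  sumFin-cong (suc n) f≗g = cong₂ _+_ (f≗g zero) (sumFin-cong n (λ i → f≗g (suc i)))

  sumFin-distrib-+ : ∀ n (f g : Fin n → ℕ) →
                     sumFin n (λ i → f i + g i) ≡ sumFin n f + sumFin n g
  sumFin-distrib-+ zero    f g = refl
  sumFin-distrib-+ (suc n) f g =
    trans (cong ((f zero + g zero) +_) (sumFin-distrib-+ n _ _)) (interchange (f zero) (g zero) _ _)

  sumFin-*ˡ : ∀ n c (f : Fin n → ℕ) → sumFin n (λ i → c * f i) ≡ c * sumFin n f
  sumFin-*ˡ zero    c f = sym (*-zeroʳ c)
  sumFin-*ˡ (suc n) c f =
    trans (cong (c * f zero +_) (sumFin-*ˡ n c _)) (sym (*-distribˡ-+ c _ _))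

  sumFin-const : ∀ n c → sumFin n (λ _ → c) ≡ n * c
  sumFin-const zero    c = refl
  sumFin-const (suc n) c = cong (c +_) (sumFin-const n c)

  sumFin-mono-≤ : ∀ n {f g : Fin n → ℕ} → (∀ i → f i ≤ g i) → sumFin n f ≤ sumFin n g
  sumFin-mono-≤ zero    f≤g = z≤n
  sumFin-mono-≤ (suc n) f≤g = +-mono-≤ (f≤g zero) (sumFin-mono-≤ n (λ i → f≤g (suc i)))

  sumFin-comm : ∀ n k (f : Fin n → Fin k → ℕ) →
    sumFin n (λ i → sumFin k (f i)) ≡ sumFin k (λ j → sumFin n (λ i → f i j))
  sumFin-comm zero    k f = sym (trans (sumFin-const k 0) (*-zeroʳ k))
  sumFin-comm (suc n) k f =
    trans (cong (sumFin k (f zero) +_) (sumFin-comm n k (λ i → f (suc i))))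
          (sym (sumFin-distrib-+ k (f zero) _))

  sumFin-average : ∀ a c (g : Fin (suc a) → ℕ) →
                   suc a * c ≤ sumFin (suc a) g → ∃ λ x → c ≤ g x
  sumFin-average zero    c g c≤∑g = zero , subst₂ _≤_ (+-identityʳ c) (+-identityʳ (g zero)) c≤∑g
  sumFin-average (suc a) c g c≤∑g with c ≤? g zero
  ... | yes c≤g₀ = zero , c≤g₀
  ... | no  c≰g₀ =
    let x , c≤gx = sumFin-average a c (λ i → g (suc i))
                     (+-cancelˡ-≤ c _ _ (≤-trans c≤∑g (+-monoˡ-≤ _ (<⇒≤ (≰⇒> c≰g₀)))))
    in suc x , c≤gx

  sumVectors : ∀ m A → (Vector (Fin A) m → ℕ) → ℕ
  sumVectors zero    A g = g []
  sumVectors (suc m) A g = sumFin A (λ x → sumVectors m A (λ t → g (x ∷ t)))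

  sumVectors-cong : ∀ m A {f g : Vector (Fin A) m → ℕ} →
                    (∀ t → f t ≡ g t) → sumVectors m A f ≡ sumVectors m A g
  sumVectors-cong zero    A f≗g = f≗g []
  sumVectors-cong (suc m) A f≗g =
    sumFin-cong A (λ x → sumVectors-cong m A (λ t → f≗g (x ∷ t)))

  sumVectors-distrib-+ : ∀ m A (f g : Vector (Fin A) m → ℕ) →
    sumVectors m A (λ t → f t + g t) ≡ sumVectors m A f + sumVectors m A g
  sumVectors-distrib-+ zero    A f g = refl
  sumVectors-distrib-+ (suc m) A f g =
    trans (sumFin-cong A (λ x → sumVectors-distrib-+ m A _ _)) (sumFin-distrib-+ A _ _)

  sumVectors-*ˡ : ∀ m A c (f : Vector (Fin A) m → ℕ) →
                  sumVectors m A (λ t → c * f t) ≡ c * sumVectors m A f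
  sumVectors-*ˡ zero    A c f = refl
  sumVectors-*ˡ (suc m) A c f =
    trans (sumFin-cong A (λ x → sumVectors-*ˡ m A c _)) (sumFin-*ˡ A c _)

  sumVectors-const : ∀ m A c → sumVectors m A (λ _ → c) ≡ A ^ m * c
  sumVectors-const zero    A c = sym (+-identityʳ c)
  sumVectors-const (suc m) A c =
    trans (sumFin-cong A (λ _ → sumVectors-const m A c))
          (trans (sumFin-const A _) (sym (*-assoc A (A ^ m) c)))

  sumVectors-mono-≤ : ∀ m A {f g : Vector (Fin A) m → ℕ} →
                      (∀ t → f t ≤ g t) → sumVectors m A f ≤ sumVectors m A g
  sumVectors-mono-≤ zero    A f≤g = f≤g []
  sumVectors-mono-≤ (suc m) A f≤g =
    sumFin-mono-≤ A (λ x → sumVectors-mono-≤ m A (λ t → f≤g (x ∷ t)))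

  sumVectors-sumFin : ∀ m A n (f : Fin n → Vector (Fin A) m → ℕ) →
    sumVectors m A (λ t → sumFin n (λ i → f i t)) ≡ sumFin n (λ i → sumVectors m A (f i))
  sumVectors-sumFin zero    A n f = refl
  sumVectors-sumFin (suc m) A n f =
    trans (sumFin-cong A (λ x → sumVectors-sumFin m A n (λ i t → f i (x ∷ t))))
          (sumFin-comm A n (λ x i → sumVectors m A (λ t → f i (x ∷ t))))

  sumVectors-average : ∀ m a c (g : Vector (Fin (suc a)) m → ℕ) →
                       suc a ^ m * c ≤ sumVectors m (suc a) g → ∃ λ t → c ≤ g t
  sumVectors-average zero    a c g c≤g = [] , subst (_≤ g []) (+-identityʳ c) c≤g
  sumVectors-average (suc m) a c g c≤∑g =
    let x , c′≤gx = sumFin-average a (suc a ^ m * c) (λ x → sumVectors m (suc a) (λ t → g (x ∷ t)))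
                      (subst (_≤ sumVectors (suc m) (suc a) g) (*-assoc (suc a) (suc a ^ m) c) c≤∑g)
        t , c≤gxt = sumVectors-average m a c (λ t → g (x ∷ t)) c′≤gx
    in x ∷ t , c≤gxt

module Counting where

  open Sums
  open import Data.Nat using (zero; _+_; _*_; _^_; _≤_; z≤n; NonZero)
  open import Data.Nat.Properties
  open import Data.Nat.Tactic.RingSolver using (solve-∀)
  open import Data.Fin using (zero; suc)
  open import Data.Bool using (true; false; _∧_; _∨_; not)
  open import Data.Vec.Functional using (foldr)
  open import Data.List using ([]; _∷_)
  open import Data.Product using (_,_)
  open import Relation.Nullary using (yes; no; does; ¬_)
  open import Relation.Binary.PropositionalEquality using (refl; sym; trans; cong; module ≡-Reasoning)

  indicator-∧ : ∀ p q → indicator (p ∧ q) ≡ indicator p * indicator q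
  indicator-∧ true  q = sym (+-identityʳ _)
  indicator-∧ false q = refl

  indicator-not-∨ : ∀ p q → indicator (not (p ∨ q)) ≡ indicator (not p) * indicator (not q)
  indicator-not-∨ true  q = refl
  indicator-not-∨ false q = sym (+-identityʳ _)

  bernoulli : ∀ k c d → c ^ suc k + suc k * d * c ^ k ≤ (c + d) ^ suc k
  bernoulli zero    c d = ≤-reflexive (base c d)
    where
    base : ∀ c d → c * 1 + 1 * d * 1 ≡ (c + d) * 1
    base = solve-∀
  bernoulli (suc k) c d = begin
    c * (c * c ^ k) + (2 + k) * d * (c * c ^ k)
      ≤⟨ m≤m+n _ _ ⟩
    c * (c * c ^ k) + (2 + k) * d * (c * c ^ k) + (1 + k) * d * d * c ^ k
      ≡⟨ step c d k (c ^ k) ⟩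
    (c + d) * (c * c ^ k + suc k * d * c ^ k)
      ≤⟨ *-monoʳ-≤ (c + d) (bernoulli k c d) ⟩
    (c + d) * (c + d) ^ suc k ∎
    where
    open ≤-Reasoning
    step : ∀ c d k y → c * (c * y) + (2 + k) * d * (c * y) + (1 + k) * d * d * y
                      ≡ (c + d) * (c * y + (1 + k) * d * y)
    step = solve-∀

  any : ∀ {m A} → (Fin A → Bool) → Vector (Fin A) m → Bool
  any h = foldr (λ x b → h x ∨ b) false

  any-witness : ∀ m {A} (h : Fin A → Bool) (t : Vector (Fin A) m) →
                any h t ≡ true → ∃ λ l → h (t l) ≡ true
  any-witness zero    h t ()
  any-witness (suc m) h t any≡true with h (t zero) in h₀≡true
  ... | true  = zero , h₀≡true
  ... | false = let l , hₗ≡true = any-witness m h (λ l → t (suc l)) any≡true in suc l , hₗ≡true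

  sumVectors-none : ∀ m A (h : Fin A → Bool) →
    sumVectors m A (λ t → indicator (not (any h t))) ≡ sumFin A (λ x → indicator (not (h x))) ^ m
  sumVectors-none zero    A h = refl
  sumVectors-none (suc m) A h = begin
    sumFin A (λ x → sumVectors m A (λ t → indicator (not (h x ∨ any h t))))
      ≡⟨ sumFin-cong A (λ x → sumVectors-cong m A (λ t → indicator-not-∨ (h x) (any h t))) ⟩
    sumFin A (λ x → sumVectors m A (λ t → miss x * indicator (not (any h t))))
      ≡⟨ sumFin-cong A (λ x → sumVectors-*ˡ m A (miss x) _) ⟩
    sumFin A (λ x → miss x * sumVectors m A (λ t → indicator (not (any h t))))
      ≡⟨ sumFin-cong A (λ x → cong (miss x *_) (sumVectors-none m A h)) ⟩
    sumFin A (λ x → miss x * total ^ m)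
      ≡⟨ sumFin-cong A (λ x → *-comm (miss x) _) ⟩
    sumFin A (λ x → total ^ m * miss x)
      ≡⟨ sumFin-*ˡ A (total ^ m) miss ⟩
    total ^ m * total
      ≡⟨ *-comm (total ^ m) total ⟩
    total ^ suc m ∎
    where
    open ≡-Reasoning
    miss : Fin A → ℕ
    miss x = indicator (not (h x))
    total : ℕ
    total = sumFin A miss

  ≤*indicator+ : ∀ {P : Set} (P? : Dec P) x y → (¬ P → x ≤ y) → x ≤ x * indicator (does P?) + y
  ≤*indicator+ (yes _)  x y _     = ≤-trans (≤-reflexive (sym (*-identityʳ x))) (m≤m+n _ y)
  ≤*indicator+ (no  ¬p) x y ¬P⇒≤ = ≤-trans (¬P⇒≤ ¬p) (m≤n+m y _)

  countVectors : ∀ {m A} {P : Vector (Fin A) m → Set} → (∀ t → Dec (P t)) → ℕ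
  countVectors {m} {A} P? = sumVectors m A (λ t → indicator (does (P? t)))

  markov : ∀ m A K .{{_ : NonZero K}} (g : Vector (Fin A) m → ℕ) →
           sumVectors m A g ≤ K * A ^ m → A ^ m ≤ 2 * countVectors (λ t → g t ≤? 2 * K)
  markov m A K g ∑g≤ = *-cancelˡ-≤ K (+-cancelʳ-≤ (K * A ^ m) _ _ (begin
    K * A ^ m + K * A ^ m
      ≡⟨ double K (A ^ m) ⟩
    A ^ m * (2 * K)
      ≡⟨ sumVectors-const m A (2 * K) ⟨
    sumVectors m A (λ _ → 2 * K)
      ≤⟨ sumVectors-mono-≤ m A below ⟩
    sumVectors m A (λ t → 2 * K * small t + g t)
      ≡⟨ sumVectors-distrib-+ m A _ g ⟩
    sumVectors m A (λ t → 2 * K * small t) + sumVectors m A g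
      ≡⟨ cong (_+ sumVectors m A g) (sumVectors-*ˡ m A (2 * K) small) ⟩
    2 * K * #small + sumVectors m A g
      ≤⟨ +-monoʳ-≤ (2 * K * #small) ∑g≤ ⟩
    2 * K * #small + K * A ^ m
      ≡⟨ cong (_+ K * A ^ m) (regroup K #small) ⟩
    K * (2 * #small) + K * A ^ m ∎))
    where
    open ≤-Reasoning
    small : Vector (Fin A) m → ℕ
    small t = indicator (does (g t ≤? 2 * K))
    #small : ℕ
    #small = countVectors (λ t → g t ≤? 2 * K)
    below : ∀ t → 2 * K ≤ 2 * K * small t + g t
    below t = ≤*indicator+ (g t ≤? 2 * K) (2 * K) (g t) (λ g≰2K → <⇒≤ (≰⇒> g≰2K))
    double : ∀ k x → k * x + k * x ≡ x * (2 * k)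
    double = solve-∀
    regroup : ∀ k s → 2 * k * s ≡ k * (2 * s)
    regroup = solve-∀

  length-filter-∷ : ∀ {K : Set} {P : K → Set} (P? : ∀ k → Dec (P k)) k C →
    length (filter P? (k ∷ C)) ≡ indicator (does (P? k)) + length (filter P? C)
  length-filter-∷ P? k C with does (P? k)
  ... | true  = refl
  ... | false = refl

  module _ {K : Set} {m a : ℕ} {P : K → Vector (Fin (suc a)) m → Set}
           (P? : ∀ k t → Dec (P k t))
           (frequent : ∀ k → suc a ^ m ≤ 2 * countVectors (P? k)) where

    private
      survivors : List K → Vector (Fin (suc a)) m → ℕ
      survivors C t = length (filter (λ k → P? k t) C)

      total : ∀ C → suc a ^ m * length C ≤ sumVectors m (suc a) (λ t → 2 * survivors C t)
      total []      = ≤-trans (≤-reflexive (*-zeroʳ (suc a ^ m))) z≤n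
      total (k ∷ C) = begin
        suc a ^ m * suc (length C)
          ≡⟨ *-suc (suc a ^ m) (length C) ⟩
        suc a ^ m + suc a ^ m * length C
          ≤⟨ +-mono-≤ (frequent k) (total C) ⟩
        2 * countVectors (P? k) + sumVectors m (suc a) (λ t → 2 * survivors C t)
          ≡⟨ cong (_+ _) (sumVectors-*ˡ m (suc a) 2 _) ⟨
        sumVectors m (suc a) (λ t → 2 * hit k t) + sumVectors m (suc a) (λ t → 2 * survivors C t)
          ≡⟨ sumVectors-distrib-+ m (suc a) _ _ ⟨
        sumVectors m (suc a) (λ t → 2 * hit k t + 2 * survivors C t)
          ≡⟨ sumVectors-cong m (suc a) (λ t → sym (twice-survivors-∷ t)) ⟩
        sumVectors m (suc a) (λ t → 2 * survivors (k ∷ C) t) ∎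
        where
        open ≤-Reasoning
        hit : K → Vector (Fin (suc a)) m → ℕ
        hit k t = indicator (does (P? k t))
        twice-survivors-∷ : ∀ t → 2 * survivors (k ∷ C) t ≡ 2 * hit k t + 2 * survivors C t
        twice-survivors-∷ t = trans (cong (2 *_) (length-filter-∷ (λ k → P? k t) k C))
                                    (*-distribˡ-+ 2 (hit k t) (survivors C t))

    halving : ∀ C → ∃ λ t → length C ≤ 2 * length (filter (λ k → P? k t) C)
    halving C = sumVectors-average m a (length C) (λ t → 2 * survivors C t) (total C)

module Link {a c : ℕ} (e : Fin (suc a) → Fin (suc c) → Bool) (m : ℕ) where

  open Sums
  open Counting
  open import Data.Nat using (_+_; _*_; _^_; _≤_)
  open import Data.Nat.Properties
  open import Data.Nat.Tactic.RingSolver using (solve-∀)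
  open import Data.Bool using (true; false; _∧_; not)
  open import Relation.Binary.PropositionalEquality using (refl; sym; trans; cong; subst; module ≡-Reasoning)

  covered : Vector (Fin (suc a)) m → Fin (suc c) → Bool
  covered t z = any (λ x → e x z) t

  missed : Vector (Fin (suc a)) m → ℕ
  missed t = sumFin (suc a) (λ x → sumFin (suc c) (λ z → indicator (e x z ∧ not (covered t z))))

  private
    degree codegree : Fin (suc c) → ℕ
    degree   z = sumFin (suc a) (λ x → indicator (e x z))
    codegree z = sumFin (suc a) (λ x → indicator (not (e x z)))

    indicator-not+indicator : ∀ p → indicator (not p) + indicator p ≡ 1
    indicator-not+indicator true  = refl
    indicator-not+indicator false = refl

    codegree+degree : ∀ z → codegree z + degree z ≡ suc a
    codegree+degree z = begin
      codegree z + degree z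
        ≡⟨ sumFin-distrib-+ (suc a) (λ x → indicator (not (e x z))) (λ x → indicator (e x z)) ⟨
      sumFin (suc a) (λ x → indicator (not (e x z)) + indicator (e x z))
        ≡⟨ sumFin-cong (suc a) (λ x → indicator-not+indicator (e x z)) ⟩
      sumFin (suc a) (λ _ → 1)
        ≡⟨ sumFin-const (suc a) 1 ⟩
      suc a * 1
        ≡⟨ *-identityʳ (suc a) ⟩
      suc a ∎
      where open ≡-Reasoning

    sumVectors-missed : sumVectors m (suc a) missed ≡ sumFin (suc c) (λ z → degree z * codegree z ^ m)
    sumVectors-missed = begin
      sumVectors m (suc a) missed
        ≡⟨ sumVectors-sumFin m (suc a) (suc a) (λ x t → sumFin (suc c) (λ z → uncovered x z t)) ⟩
      sumFin (suc a) (λ x → sumVectors m (suc a) (λ t → sumFin (suc c) (λ z → uncovered x z t)))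
        ≡⟨ sumFin-cong (suc a) (λ x → sumVectors-sumFin m (suc a) (suc c) (uncovered x)) ⟩
      sumFin (suc a) (λ x → sumFin (suc c) (λ z → sumVectors m (suc a) (uncovered x z)))
        ≡⟨ sumFin-cong (suc a) (λ x → sumFin-cong (suc c) (λ z → avoiding x z)) ⟩
      sumFin (suc a) (λ x → sumFin (suc c) (λ z → codegree z ^ m * indicator (e x z)))
        ≡⟨ sumFin-comm (suc a) (suc c) (λ x z → codegree z ^ m * indicator (e x z)) ⟩
      sumFin (suc c) (λ z → sumFin (suc a) (λ x → codegree z ^ m * indicator (e x z)))
        ≡⟨ sumFin-cong (suc c) (λ z → trans (sumFin-*ˡ (suc a) (codegree z ^ m) (λ x → indicator (e x z)))
                                             (*-comm (codegree z ^ m) (degree z))) ⟩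
      sumFin (suc c) (λ z → degree z * codegree z ^ m) ∎
      where
      open ≡-Reasoning
      uncovered : Fin (suc a) → Fin (suc c) → Vector (Fin (suc a)) m → ℕ
      uncovered x z t = indicator (e x z ∧ not (covered t z))
      avoiding : ∀ x z → sumVectors m (suc a) (uncovered x z) ≡ codegree z ^ m * indicator (e x z)
      avoiding x z = begin
        sumVectors m (suc a) (uncovered x z)
          ≡⟨ sumVectors-cong m (suc a) (λ t → indicator-∧ (e x z) (not (covered t z))) ⟩
        sumVectors m (suc a) (λ t → indicator (e x z) * indicator (not (covered t z)))
          ≡⟨ sumVectors-*ˡ m (suc a) (indicator (e x z)) _ ⟩
        indicator (e x z) * sumVectors m (suc a) (λ t → indicator (not (covered t z)))
          ≡⟨ cong (indicator (e x z) *_) (sumVectors-none m (suc a) (λ x → e x z)) ⟩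
        indicator (e x z) * codegree z ^ m
          ≡⟨ *-comm (indicator (e x z)) _ ⟩
        codegree z ^ m * indicator (e x z) ∎

  missed-total : sumVectors m (suc a) (λ t → suc m * missed t) ≤ (suc a * suc c) * suc a ^ m
  missed-total = begin
    sumVectors m (suc a) (λ t → suc m * missed t)
      ≡⟨ sumVectors-*ˡ m (suc a) (suc m) missed ⟩
    suc m * sumVectors m (suc a) missed
      ≡⟨ cong (suc m *_) sumVectors-missed ⟩
    suc m * sumFin (suc c) (λ z → degree z * codegree z ^ m)
      ≡⟨ sumFin-*ˡ (suc c) (suc m) (λ z → degree z * codegree z ^ m) ⟨
    sumFin (suc c) (λ z → suc m * (degree z * codegree z ^ m))
      ≤⟨ sumFin-mono-≤ (suc c) linear-term ⟩
    sumFin (suc c) (λ _ → suc a ^ suc m)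
      ≡⟨ sumFin-const (suc c) _ ⟩
    suc c * suc a ^ suc m
      ≡⟨ regroup (suc c) (suc a) (suc a ^ m) ⟩
    (suc a * suc c) * suc a ^ m ∎
    where
    open ≤-Reasoning
    regroup : ∀ c a y → c * (a * y) ≡ (a * c) * y
    regroup = solve-∀
    linear-term : ∀ z → suc m * (degree z * codegree z ^ m) ≤ suc a ^ suc m
    linear-term z = subst (λ n → suc m * (degree z * codegree z ^ m) ≤ n ^ suc m) (codegree+degree z)
      (≤-trans (≤-reflexive (sym (*-assoc (suc m) (degree z) _)))
               (≤-trans (m≤n+m _ _) (bernoulli m (codegree z) (degree z))))

  covering-frequent : suc a ^ m ≤ 2 * countVectors (λ t → suc m * missed t ≤? 2 * (suc a * suc c))
  covering-frequent = markov m (suc a) (suc a * suc c) (λ t → suc m * missed t) missed-total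

module Trim {a b c : ℕ} (T : Fin (suc a) → Fin (suc b) → Fin (suc c) → Bool) (γ : Fin (suc b))
            {m : ℕ} (t : Vector (Fin (suc a)) m) where

  open Sums
  open Counting
  open Link (λ x z → T x γ z) m public
  open import Data.Nat using (_+_; _*_)
  open import Data.Fin using (_≟_)
  open import Data.Bool using (true; false; _∧_; not)
  open import Data.Product using (_,_)
  open import Data.Bool.Properties using (∧-conicalˡ; ∧-conicalʳ)
  open import Data.Empty using (⊥-elim)
  open import Data.Integer using (+_)
  open import Data.Rational using (_/_)
  open import Relation.Nullary using (yes; no)
  open import Relation.Binary.PropositionalEquality using (_≢_; refl; sym; trans; cong; cong₂; module ≡-Reasoning)

  trim : Fin (suc a) → Fin (suc b) → Fin (suc c) → Bool
  trim x y z with y ≟ γ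
  ... | yes _ = T x y z ∧ covered t z
  ... | no  _ = T x y z

  trim⇒edge : ∀ x y z → trim x y z ≡ true → T x y z ≡ true
  trim⇒edge x y z trim≡true with y ≟ γ
  ... | yes _ = ∧-conicalˡ _ _ trim≡true
  ... | no  _ = trim≡true

  trim-≢ : ∀ x y z → y ≢ γ → trim x y z ≡ T x y z
  trim-≢ x y z y≢γ with y ≟ γ
  ... | yes y≡γ = ⊥-elim (y≢γ y≡γ)
  ... | no  _   = refl

  trim-γ : ∀ x z → trim x γ z ≡ (T x γ z ∧ covered t z)
  trim-γ x z with γ ≟ γ
  ... | yes _   = refl
  ... | no  γ≢γ = ⊥-elim (γ≢γ refl)

  trim-covered : ∀ z → (∃ λ x → trim x γ z ≡ true) → ∃ λ l → trim (t l) γ z ≡ true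
  trim-covered z (x , trim≡true) =
    let z-covered = ∧-conicalʳ _ _ (trans (sym (trim-γ x z)) trim≡true)
        l , tₗ-edge = any-witness m (λ x → T x γ z) t z-covered
    in l , trans (trim-γ (t l) z) (cong₂ _∧_ tₗ-edge z-covered)

  edgeCount : (Fin (suc a) → Fin (suc b) → Fin (suc c) → Bool) → Fin (suc b) → ℕ
  edgeCount S v = sumFin (suc a) (λ x → sumFin (suc c) (λ z → indicator (S x v z)))

  triadDegree-trim-≢ : ∀ v → v ≢ γ → triadDegree a b c trim v ≡ triadDegree a b c T v
  triadDegree-trim-≢ v v≢γ = cong (λ s → (+ s) / (suc a * suc c))
    (sumFin-cong (suc a) (λ x → sumFin-cong (suc c) (λ z → cong indicator (trim-≢ x v z v≢γ))))

  edgeCount-γ : edgeCount T γ ≡ edgeCount trim γ + missed t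
  edgeCount-γ = begin
    edgeCount T γ
      ≡⟨ sumFin-cong (suc a) (λ x → sumFin-cong (suc c) (λ z → split x z)) ⟩
    sumFin (suc a) (λ x → sumFin (suc c) (λ z → kept x z + lost x z))
      ≡⟨ sumFin-cong (suc a) (λ x → sumFin-distrib-+ (suc c) (kept x) (lost x)) ⟩
    sumFin (suc a) (λ x → sumFin (suc c) (kept x) + sumFin (suc c) (lost x))
      ≡⟨ sumFin-distrib-+ (suc a) (λ x → sumFin (suc c) (kept x)) (λ x → sumFin (suc c) (lost x)) ⟩
    edgeCount trim γ + missed t ∎
    where
    open ≡-Reasoning
    kept lost : Fin (suc a) → Fin (suc c) → ℕ
    kept x z = indicator (trim x γ z)
    lost x z = indicator (T x γ z ∧ not (covered t z))
    indicator-split : ∀ p q → indicator p ≡ indicator (p ∧ q) + indicator (p ∧ not q)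
    indicator-split true  true  = refl
    indicator-split true  false = refl
    indicator-split false q     = refl
    split : ∀ x z → indicator (T x γ z) ≡ kept x z + lost x z
    split x z = trans (indicator-split (T x γ z) (covered t z))
                      (cong (λ p → indicator p + lost x z) (sym (trim-γ x z)))

  triadDegree-γ : triadDegree a b c T γ ≡ (+ (edgeCount trim γ + missed t)) / (suc a * suc c)
  triadDegree-γ = cong (λ s → (+ s) / (suc a * suc c)) edgeCount-γ

module Epsilon (p q : ℕ) .(coprime : Coprime (suc p) (suc q)) where

  open import Data.Nat using (_+_; _*_; _<_; _≤_)
  open import Data.Nat.Properties
  open import Data.Nat.DivMod using (_/_; m≡m%n+[m/n]*n; m%n<n; m/n*n≤m)
  open import Data.Nat.Tactic.RingSolver using (solve-∀)
  import Data.Integer as ℤ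
  open import Data.Integer using (+_; +[1+_])
  import Data.Integer.Properties as ℤ
  import Data.Integer.Tactic.RingSolver as ℤ-Solver
  open import Data.Rational as ℚ using (ℚ; mkℚ; toℚᵘ) renaming (_/_ to _/ℚ_; _≤_ to _≤ℚ_)
  open import Data.Rational.Properties using (toℚᵘ-cancel-≤; toℚᵘ-homo-+; toℚᵘ-homo‿-; toℚᵘ-fromℚᵘ; toℚᵘ-homo-*)
  import Data.Rational.Unnormalised as ℚᵘ
  import Data.Rational.Unnormalised.Properties as ℚᵘ
  open import Relation.Binary.PropositionalEquality using (sym; cong; subst; subst₂; module ≡-Reasoning)

  ε : ℚ
  ε = mkℚ +[1+ p ] q coprime

  m : ℕ
  m = (2 * suc q) / suc p

  m*[1+p]≤2[1+q] : m * suc p ≤ 2 * suc q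
  m*[1+p]≤2[1+q] = m/n*n≤m (2 * suc q) (suc p)

  2[1+q]<[1+m]*[1+p] : 2 * suc q < suc m * suc p
  2[1+q]<[1+m]*[1+p] = subst (_< suc m * suc p) (sym (m≡m%n+[m/n]*n (2 * suc q) (suc p)))
                         (+-monoˡ-< (m * suc p) (m%n<n (2 * suc q) (suc p)))

  m≤2/ε : (+ m) /ℚ 1 ≤ℚ twoOver ε
  m≤2/ε = toℚᵘ-cancel-≤
    (ℚᵘ.≤-respˡ-≃ (ℚᵘ.≃-sym (toℚᵘ-fromℚᵘ (ℚᵘ.mkℚᵘ (+ m) 0)))
      (ℚᵘ.≤-respʳ-≃ (ℚᵘ.≃-sym (toℚᵘ-homo-* ((+ 2) /ℚ 1) (ℚ.1/ ε)))
        (ℚᵘ.*≤* (subst₂ ℤ._≤_ (ℤ.pos-* m (suc (p + 0))) (ℤ.pos-* (2 * suc q) 1) (ℤ.+≤+ nat)))))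
    where
    -- the normal form of toℚᵘ (2/ε) has denominator suc (p + 0)
    nat : m * suc (p + 0) ≤ 2 * suc q * 1
    nat = subst₂ _≤_ (cong (λ k → m * suc k) (sym (+-identityʳ p))) (sym (*-identityʳ (2 * suc q)))
                 m*[1+p]≤2[1+q]

  private
    L[1+q]≤[1+p]D : ∀ L D → suc m * L ≤ 2 * D → L * suc q ≤ suc p * D
    L[1+q]≤[1+p]D L D [1+m]L≤2D = *-cancelˡ-≤ (suc m) (begin
      suc m * (L * suc q)  ≡⟨ *-assoc (suc m) L (suc q) ⟨
      suc m * L * suc q    ≤⟨ *-monoˡ-≤ (suc q) [1+m]L≤2D ⟩
      2 * D * suc q        ≡⟨ regroup₁ D (suc q) ⟩
      D * (2 * suc q)      ≤⟨ *-monoʳ-≤ D (<⇒≤ 2[1+q]<[1+m]*[1+p]) ⟩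
      D * (suc m * suc p)  ≡⟨ regroup₂ D (suc m) (suc p) ⟩
      suc m * (suc p * D)  ∎)
      where
      open ≤-Reasoning
      regroup₁ : ∀ d k → 2 * d * k ≡ d * (2 * k)
      regroup₁ = solve-∀
      regroup₂ : ∀ d a b → d * (a * b) ≡ a * (b * d)
      regroup₂ = solve-∀

    difference : ∀ S L d → toℚᵘ ((+ (S + L)) /ℚ suc d ℚ.- (+ S) /ℚ suc d) ℚᵘ.≃ ℚᵘ.mkℚᵘ (+ L) d
    difference S L d = ℚᵘ.≃-trans (toℚᵘ-homo-+ X (ℚ.- Y))
      (ℚᵘ.≃-trans (ℚᵘ.+-cong (toℚᵘ-fromℚᵘ (ℚᵘ.mkℚᵘ (+ (S + L)) d))
                             (ℚᵘ.≃-trans (toℚᵘ-homo‿- Y) (ℚᵘ.-‿cong (toℚᵘ-fromℚᵘ (ℚᵘ.mkℚᵘ (+ S) d)))))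
                  (ℚᵘ.*≡* cross-multiplied))
      where
      X Y : ℚ
      X = (+ (S + L)) /ℚ suc d
      Y = (+ S) /ℚ suc d
      D : ℤ.ℤ
      D = + suc d
      identity : ∀ s l D → ((s ℤ.+ l) ℤ.* D ℤ.+ (ℤ.- s) ℤ.* D) ℤ.* D ≡ l ℤ.* (D ℤ.* D)
      identity = ℤ-Solver.solve-∀
      cross-multiplied : ((+ (S + L)) ℤ.* D ℤ.+ (ℤ.- (+ S)) ℤ.* D) ℤ.* D ≡ + L ℤ.* + (suc d * suc d)
      cross-multiplied = begin
        ((+ (S + L)) ℤ.* D ℤ.+ (ℤ.- (+ S)) ℤ.* D) ℤ.* D
          ≡⟨ cong (λ n → (n ℤ.* D ℤ.+ (ℤ.- (+ S)) ℤ.* D) ℤ.* D) (ℤ.pos-+ S L) ⟩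
        ((+ S ℤ.+ + L) ℤ.* D ℤ.+ (ℤ.- (+ S)) ℤ.* D) ℤ.* D
          ≡⟨ identity (+ S) (+ L) D ⟩
        + L ℤ.* (D ℤ.* D)
          ≡⟨ cong (+ L ℤ.*_) (ℤ.pos-* (suc d) (suc d)) ⟨
        + L ℤ.* + (suc d * suc d) ∎
        where open ≡-Reasoning

  loss≤ε : ∀ S L d → suc m * L ≤ 2 * suc d → (+ (S + L)) /ℚ suc d ℚ.- (+ S) /ℚ suc d ≤ℚ ε
  loss≤ε S L d [1+m]L≤2D = toℚᵘ-cancel-≤ (ℚᵘ.≤-respˡ-≃ (ℚᵘ.≃-sym (difference S L d))
    (ℚᵘ.*≤* (subst₂ ℤ._≤_ (ℤ.pos-* L (suc q)) (ℤ.pos-* (suc p) (suc d))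
                          (ℤ.+≤+ (L[1+q]≤[1+p]D L (suc d) [1+m]L≤2D)))))

  trim-loss : ∀ {a b c} (T : Fin (suc a) → Fin (suc b) → Fin (suc c) → Bool) (γ : Fin (suc b))
              (t : Vector (Fin (suc a)) m) →
              suc m * Link.missed (λ x z → T x γ z) m t ≤ 2 * (suc a * suc c) →
              triadDegree a b c T γ ℚ.- triadDegree a b c (Trim.trim T γ t) γ ≤ℚ ε
  trim-loss {a} {b} {c} T γ t covering =
    subst (λ d → d ℚ.- triadDegree a b c trim γ ≤ℚ ε) (sym triadDegree-γ)
          (loss≤ε (edgeCount trim γ) (missed t) _ covering)
    where open Trim T γ t

module Greedy where

  open import Data.Nat using (zero; _+_; _*_; _^_; _≤_; s≤s)
  open import Data.Nat.Properties
  open import Data.Fin using (zero; suc) renaming (_<_ to _<ᶠ_)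
  open import Data.List using ([]; _∷_; lookup)
  open import Data.List.Membership.Propositional using (_∈_)
  open import Data.List.Membership.Propositional.Properties using (∈-filter⁻)
  import Data.List.Relation.Unary.All as All
  open import Data.List.Relation.Unary.Any using (here; there)
  open import Data.List.Relation.Unary.AllPairs using (AllPairs; _∷_)
  import Data.List.Relation.Unary.AllPairs.Properties as AllPairs
  open import Data.Product using (proj₁; proj₂)
  open import Data.Empty using (⊥-elim)
  open import Relation.Binary.PropositionalEquality using (refl; sym; cong)

  -- 2 ^ budget r l candidates suffice to pick r more indices after l earlier ones: a pick
  -- uses up one candidate and halves the others once per earlier index.
  budget : ℕ → ℕ → ℕ
  budget zero    l = 0
  budget (suc r) l = suc (l + budget r (suc l))

  module Picking {N : ℕ} (Survives : Fin N → Fin N → List (Fin N) → Fin N → Set)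
                 (survives? : ∀ a b C k → Dec (Survives a b C k))
                 (halves : ∀ a b C → length C ≤ 2 * length (filter (survives? a b C) C)) where

    Increasing : List (Fin N) → Set
    Increasing = AllPairs _<ᶠ_

    sieve : Fin N → List (Fin N) → List (Fin N) → List (Fin N)
    sieve x []       C = C
    sieve x (p ∷ ps) C = sieve x ps (filter (survives? p x C) C)

    stage : Fin N → (prev : List (Fin N)) → List (Fin N) → Fin (length prev) → List (Fin N)
    stage x (p ∷ ps) C zero    = C
    stage x (p ∷ ps) C (suc i) = stage x ps (filter (survives? p x C) C) i

    sieve-⊆ : ∀ x prev C {k} → k ∈ sieve x prev C → k ∈ C
    sieve-⊆ x []       C k∈ = k∈
    sieve-⊆ x (p ∷ ps) C k∈ = proj₁ (∈-filter⁻ (survives? p x C) {xs = C} (sieve-⊆ x ps _ k∈))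

    sieve-increasing : ∀ x prev C → Increasing C → Increasing (sieve x prev C)
    sieve-increasing x []       C C↑ = C↑
    sieve-increasing x (p ∷ ps) C C↑ = sieve-increasing x ps _ (AllPairs.filter⁺ (survives? p x C) C↑)

    sieve-survives : ∀ x prev C {k} → k ∈ sieve x prev C →
                     ∀ i → Survives (lookup prev i) x (stage x prev C i) k
    sieve-survives x (p ∷ ps) C k∈ zero    =
      proj₂ (∈-filter⁻ (survives? p x C) {xs = C} (sieve-⊆ x ps _ k∈))
    sieve-survives x (p ∷ ps) C k∈ (suc i) = sieve-survives x ps _ k∈ i

    sieve-size : ∀ x prev C s → 2 ^ (length prev + s) ≤ length C → 2 ^ s ≤ length (sieve x prev C)
    sieve-size x []       C s large = large
    sieve-size x (p ∷ ps) C s large =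
      sieve-size x ps _ s (*-cancelˡ-≤ 2 (≤-trans large (halves p x C)))

    -- prev lists the vertices picked so far, most recent first; prevPool p j is the
    -- candidate list relative to which the pair (lookup prev p, pick j) is handled.
    record Selection (r : ℕ) (prev C : List (Fin N)) : Set where
      field
        pick              : Fin r → Fin N
        pick∈             : ∀ j → pick j ∈ C
        pick-increasing   : ∀ i j → i <ᶠ j → pick i <ᶠ pick j
        pool              : Fin r → Fin r → List (Fin N)
        pool-survives     : ∀ i j k → i <ᶠ j → j <ᶠ k → Survives (pick i) (pick j) (pool i j) (pick k)
        prevPool          : Fin (length prev) → Fin r → List (Fin N)
        prevPool-survives : ∀ p j k → j <ᶠ k → Survives (lookup prev p) (pick j) (prevPool p j) (pick k)

    private
      2^k≤pred : ∀ k n → 2 ^ suc k ≤ suc n → 2 ^ k ≤ n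
      2^k≤pred k n 2^[1+k]≤1+n = ≤-pred (≤-trans (+-monoˡ-≤ (2 ^ k) (m^n>0 2 k))
        (≤-trans (≤-reflexive (cong (2 ^ k +_) (sym (+-identityʳ (2 ^ k))))) 2^[1+k]≤1+n))

    select : ∀ r prev C → Increasing C → 2 ^ budget r (length prev) ≤ length C → Selection r prev C
    select zero    prev C       _          _     = record
      { pick = λ () ; pick∈ = λ () ; pick-increasing = λ () ; pool = λ () ; pool-survives = λ ()
      ; prevPool = λ _ () ; prevPool-survives = λ _ () }
    select (suc r) prev []       _          large =
      ⊥-elim (<⇒≱ (m^n>0 2 (budget (suc r) (length prev))) large)
    select (suc r) prev (x ∷ xs) (x< ∷ xs↑) large = record
      { pick = pick ; pick∈ = pick∈ ; pick-increasing = pick-increasing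
      ; pool = pool ; pool-survives = pool-survives
      ; prevPool = prevPool ; prevPool-survives = prevPool-survives }
      where
      rest : Selection r (x ∷ prev) (sieve x prev xs)
      rest = select r (x ∷ prev) (sieve x prev xs) (sieve-increasing x prev xs xs↑)
               (sieve-size x prev xs _ (2^k≤pred (length prev + budget r (suc (length prev))) _ large))
      module R = Selection rest
      pick : Fin (suc r) → Fin N
      pick zero    = x
      pick (suc j) = R.pick j
      pick∈ : ∀ j → pick j ∈ x ∷ xs
      pick∈ zero    = here refl
      pick∈ (suc j) = there (sieve-⊆ x prev xs (R.pick∈ j))
      pick-increasing : ∀ i j → i <ᶠ j → pick i <ᶠ pick j
      pick-increasing zero    (suc j) _       = All.lookup x< (sieve-⊆ x prev xs (R.pick∈ j))
      pick-increasing (suc i) (suc j) (s≤s i<j) = R.pick-increasing i j i<j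
      pool : Fin (suc r) → Fin (suc r) → List (Fin N)
      pool zero    (suc j) = R.prevPool zero j
      pool (suc i) (suc j) = R.pool i j
      pool _       zero    = []
      pool-survives : ∀ i j k → i <ᶠ j → j <ᶠ k → Survives (pick i) (pick j) (pool i j) (pick k)
      pool-survives zero    (suc j) (suc k) _         (s≤s j<k) = R.prevPool-survives zero j k j<k
      pool-survives (suc i) (suc j) (suc k) (s≤s i<j) (s≤s j<k) = R.pool-survives i j k i<j j<k
      prevPool : Fin (length prev) → Fin (suc r) → List (Fin N)
      prevPool p zero    = stage x prev xs p
      prevPool p (suc j) = R.prevPool (suc p) j
      prevPool-survives : ∀ p j k → j <ᶠ k → Survives (lookup prev p) (pick j) (prevPool p j) (pick k)
      prevPool-survives p zero    (suc k) _         = sieve-survives x prev xs (R.pick∈ k) p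
      prevPool-survives p (suc j) (suc k) (s≤s j<k) = R.prevPool-survives (suc p) j k j<k

module Construction (p q : ℕ) .(coprime : Coprime (suc p) (suc q)) (n : ℕ) {N : ℕ}
                    (large : 2 ℕ.^ Greedy.budget n 0 ℕ.≤ N)
                    (H : PHyp N) (γ : (i k : Fin N) → Fin (part H i k)) where

  open Epsilon p q coprime
  open Counting using (halving)
  open Greedy using (budget)
  open import Data.Nat using (_*_; _^_; _≤_; _≤?_)
  open import Data.List using ([]; allFin)
  open import Data.List.Properties using (length-tabulate)
  import Data.List.Relation.Unary.AllPairs.Properties as AllPairs
  open import Data.Product using (proj₁; proj₂)
  open import Relation.Binary.PropositionalEquality using (sym; subst)

  link : ∀ a b k → Fin (part H a b) → Fin (part H b k) → Bool
  link a b k x z = edge H a b k x (γ a k) z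

  Covers : ∀ a b k → Vector (Fin (part H a b)) m → Set
  Covers a b k t = suc m * Link.missed (link a b k) m t ≤ 2 * (part H a b * part H b k)

  covers? : ∀ a b k t → Dec (Covers a b k t)
  covers? a b k t = _ ≤? _

  tupleFor : ∀ a b C → ∃ λ t → length C ≤ 2 * length (filter (λ k → covers? a b k t) C)
  tupleFor a b = halving (covers? a b) (λ k → Link.covering-frequent (link a b k) m)

  tuple : ∀ a b → List (Fin N) → Vector (Fin (part H a b)) m
  tuple a b C = proj₁ (tupleFor a b C)

  open Greedy.Picking (λ a b C k → Covers a b k (tuple a b C)) (λ a b C k → covers? a b k (tuple a b C))
                      (λ a b C → proj₂ (tupleFor a b C))

  open Selection (select n [] (allFin N) (AllPairs.tabulate⁺-< (λ i<j → i<j))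
                   (subst (2 ^ budget n 0 ≤_) (sym (length-tabulate (λ i → i))) large)) public

  α : (i j : Fin n) → Vector (Fin (part H (pick i) (pick j))) m
  α i j = tuple (pick i) (pick j) (pool i j)

  module TrimAt (i j k : Fin n) = Trim (edge H (pick i) (pick j) (pick k)) (γ (pick i) (pick k)) (α i j)

open import Data.Fin using () renaming (_<_ to _<ᶠ_)
open import Data.Bool using (true)
open import Data.Integer using (+_; +[1+_]; -[1+_])
open import Data.Product using (Σ; _×_; _,_)
open import Data.Rational using (ℚ; mkℚ; Positive; _/_; _≤_; _-_)
open import Relation.Binary.PropositionalEquality using (_≢_)
open import Data.Nat.Properties using (≤-refl)

lemma18 : (ε : ℚ) → .{{_ : Positive ε}} → (n : ℕ) →
  Σ ℕ λ N → Σ ℕ λ m → ((+ m) / 1 ≤ twoOver ε) ×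
  ((H : PHyp N) →
   (γ : (i k : Fin N) → Fin (part H i k)) →
   Σ (Fin n → Fin N) λ f →
     ((a b : Fin n) → a <ᶠ b → f a <ᶠ f b) ×
     Σ ((i j k : Fin n) → Fin (part H (f i) (f j)) → Fin (part H (f i) (f k)) →
        Fin (part H (f j) (f k)) → Bool) λ E0 →
     ((i j k : Fin n) → i <ᶠ j → j <ᶠ k → ∀ x y z →
        E0 i j k x y z ≡ true → edge H (f i) (f j) (f k) x y z ≡ true) ×
     Σ ((i j : Fin n) → Fin m → Fin (part H (f i) (f j))) λ α →
     ((i j k : Fin n) → i <ᶠ j → j <ᶠ k →
        (triadDegree (sz H (f i) (f j)) (sz H (f i) (f k)) (sz H (f j) (f k))
           (edge H (f i) (f j) (f k)) (γ (f i) (f k))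
         - triadDegree (sz H (f i) (f j)) (sz H (f i) (f k)) (sz H (f j) (f k))
           (E0 i j k) (γ (f i) (f k)) ≤ ε)
        ×
        ((v : Fin (part H (f i) (f k))) → v ≢ γ (f i) (f k) →
           triadDegree (sz H (f i) (f j)) (sz H (f i) (f k)) (sz H (f j) (f k))
             (E0 i j k) v
           ≡ triadDegree (sz H (f i) (f j)) (sz H (f i) (f k)) (sz H (f j) (f k))
             (edge H (f i) (f j) (f k)) v)
        ×
        ((β : Fin (part H (f j) (f k))) →
           (∃ λ x → E0 i j k x (γ (f i) (f k)) β ≡ true) →
           ∃ λ ℓ → E0 i j k (α i j ℓ) (γ (f i) (f k)) β ≡ true)))
lemma18 (mkℚ +[1+ p ] q coprime) n =
  2 ℕ.^ Greedy.budget n 0 , m , m≤2/ε , λ H γ →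
    let open Construction p q coprime n ≤-refl H γ in
    pick , pick-increasing , TrimAt.trim ,
    (λ i j k _ _ → TrimAt.trim⇒edge i j k) , α ,
    λ i j k i<j j<k →
      trim-loss (edge H (pick i) (pick j) (pick k)) (γ (pick i) (pick k)) (α i j)
                (pool-survives i j k i<j j<k) ,
      TrimAt.triadDegree-trim-≢ i j k ,
      TrimAt.trim-covered i j k
  where open Epsilon p q coprime
lemma18 (mkℚ (+ 0)      q _) ⦃ () ⦄ n
lemma18 (mkℚ -[1+ p ]   q _) ⦃ () ⦄ n
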